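{- Let $X$ be a finite non-empty set, $P\in\mathfrak{P}(X)$ connected, and $(a,b)\in\lessdot_P$ such that $P\setminus(a,b)$ is connected. If $(a,b)$ has the 3-chain-property, then $P\setminus(a,b)$ does not have an FPP-graph. Moreover, if $P$ has an FPP-graph, the converse also holds: if $P\setminus(a,b)$ does not have an FPP-graph, then $(a,b)$ has the 3-chain-property.
   Context: $\mathfrak{P}(X)$ is the set of all posets with carrier $X$. For a poset $P$: $[x,y]_P=\{z: x\leq_P z\leq_P y\}$; $x\lessdot_P y$ means $x<_P y$ and $[x,y]_P=\{x,y\}$; $L(P)$, $U(P)$ are the sets of minimal and maximal elements, $M(P)=X\setminus(L(P)\cup U(P))$; $\prec_P=\{(a,b)\in<_P: M(P)\cap[a,b]_P=\emptyset\}$. $P\setminus(a,b)=(X,\leq_P\setminus\{(a,b)\})$. $P$ is connected iff its comparability graph is connected. $P$ has an FPP-graph iff $P$ is connected and $P\setminus(a,b)$ is disconnected for every $(a,b)\in\prec_P$. A point $p$ is I-retractable to $q$ in $P$ iff $q$ is the maximum of $\{z: z<_P p\}$ or $q$ is the minimum of $\{z: p<_P z\}$. For $(a,b)\in\lessdot_P$ with $Q:=P\setminus(a,b)$ connected, $(a,b)$ has the 3-chain-property iff there exists $(x,y)\in\lessdot_Q$ such that $Q\setminus(x,y)$ is connected and the subposet of $P$ induced on $\{a,b,x,y\}$ is a chain $u\lessdot_P v\lessdot_P w$ with $u\in L(P)$, $w\in U(P)$ (a maximal chain of $P$), satisfying: (i) if $(x,y)\in L(P)\times U(P)$ then $[u,w]_P=\{u,v,w\}$;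 (ii) if $x\in M(P)$ then $b$ is I-retractable to $a$ in $P$; (iii) if $y\in M(P)$ then $a$ is I-retractable to $b$ in $P$. -}

module Defs where

open import Data.Nat using (ℕ)
open import Data.Fin using (Fin)
open import Data.Product using (_×_; Σ-syntax; ∃-syntax)
open import Data.Sum using (_⊎_)
open import Relation.Nullary using (¬_)
open import Relation.Binary.PropositionalEquality using (_≡_; _≢_)
open import Relation.Binary.Construct.Closure.ReflexiveTransitive using (Star)
open import Function.Bundles using (_⇔_)

-- A poset with carrier Fin n is given by its order relation R (x ≤_P y is R x y),
-- required elsewhere to satisfy IsPartialOrder _≡_ R.
Rel : ℕ → Set₁
Rel n = Fin n → Fin n → Set

module _ {n : ℕ} (R : Rel n) where

  Lt : Fin n → Fin n → Set
  Lt x y = R x y × x ≢ y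

  Cover : Fin n → Fin n → Set
  Cover x y = Lt x y × (∀ z → R x z → R z y → z ≡ x ⊎ z ≡ y)

  Minimal : Fin n → Set
  Minimal x = ∀ z → R z x → z ≡ x

  Maximal : Fin n → Set
  Maximal x = ∀ z → R x z → z ≡ x

  Middle : Fin n → Set
  Middle x = ¬ Minimal x × ¬ Maximal x

  Prec : Fin n → Fin n → Set
  Prec a b = Lt a b × (∀ z → R a z → R z b → ¬ Middle z)

  Comparable : Fin n → Fin n → Set
  Comparable x y = R x y ⊎ R y x

  Connected : Set
  Connected = ∀ x y → Star Comparable x y

  Minus : Fin n → Fin n → Rel n
  Minus a b x y = R x y × ¬ (x ≡ a × y ≡ b)

  IRetractable : Fin n → Fin n → Set
  IRetractable p q =
      (Lt q p × (∀ z → Lt z p → R z q))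
    ⊎ (Lt p q × (∀ z → Lt p z → R q z))

HasFPPGraph : {n : ℕ} → Rel n → Set
HasFPPGraph R = Connected R × (∀ a b → Prec R a b → ¬ Connected (Minus R a b))

-- 3-chain-property of (a,b) in P (the standing assumptions a ⋖_P b and
-- P ∖ (a,b) connected are hypotheses of the theorem)
ThreeChainProperty : {n : ℕ} → Rel n → Fin n → Fin n → Set
ThreeChainProperty R a b =
  let Q = Minus R a b in
  ∃[ x ] ∃[ y ] (Cover Q x y × Connected (Minus Q x y) ×
    (∃[ u ] ∃[ v ] ∃[ w ]
      ( (∀ z → (z ≡ a ⊎ z ≡ b ⊎ z ≡ x ⊎ z ≡ y) ⇔ (z ≡ u ⊎ z ≡ v ⊎ z ≡ w))
      × Cover R u v × Cover R v w × Minimal R u × Maximal R w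
      × (Minimal R x × Maximal R y → ∀ z → R u z → R z w → z ≡ u ⊎ z ≡ v ⊎ z ≡ w)
      × (Middle R x → IRetractable R b a)
      × (Middle R y → IRetractable R a b))))

{-# OPTIONS --safe #-}
module Submission where

-- Write Q = P ∖ (a,b). If (x,y) witnesses the 3-chain-property, then (a,b) and (x,y) are two
-- different steps of the maximal chain u ⋖ v ⋖ w. An endpoint of (x,y) that is not already
-- extremal in P is the middle v, and conditions (ii)/(iii) say exactly that v becomes extremal
-- once (a,b) is removed. Hence (x,y) ∈ ≺_Q although Q ∖ (x,y) is connected.
-- Conversely, if P has an FPP-graph and Q has not, finiteness lets us pick (x,y) ∈ ≺_Q with
-- Q ∖ (x,y) connected. Then P ∖ (x,y) is connected as well, so (x,y) ∉ ≺_P; this forces (x,y)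
-- to share an endpoint with (a,b), and each of the four configurations yields the 3-chain
-- a ⋖ b ⋖ y or x ⋖ a ⋖ b.

open import Defs
open import Data.Nat using (ℕ; zero; suc; _≤_; s≤s)
open import Data.Nat.Properties using (<⇒≤)
open import Data.Fin using (Fin; _≟_)
open import Data.Fin.Properties using (any?; all?; injective⇒≤)
open import Data.Product using (_×_; _,_; proj₁; proj₂; Σ; ∃-syntax)
open import Data.Sum as Sum using (_⊎_; inj₁; inj₂; [_,_])
open import Data.Empty using (⊥-elim)
open import Data.Vec using (Vec; []; _∷_)
open import Data.Vec.Relation.Unary.All as VecAll using (All; []; _∷_)
open import Data.Vec.Relation.Unary.AllPairs using ([]; _∷_)
open import Data.Vec.Relation.Unary.Unique.Propositional using (Unique)
open import Data.Vec.Relation.Unary.Unique.Propositional.Properties using (lookup-injective)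
open import Relation.Nullary using (¬_; Dec; yes; no)
open import Relation.Nullary.Decidable using (_→-dec_; _×-dec_; _⊎-dec_; ¬?)
open import Relation.Binary.Definitions using (Decidable)
open import Relation.Binary.Structures using (IsPartialOrder)
open import Relation.Binary.PropositionalEquality using (_≡_; _≢_; refl; sym)
open import Relation.Binary.Construct.Closure.ReflexiveTransitive using (Star; ε; _◅_; gmap)
open import Function using (id; _∘_)
open import Function.Bundles using (_⇔_; mk⇔; Equivalence)

module FiniteReachability {N : ℕ} {E : Fin N → Fin N → Set} (E? : Decidable E) where

  data Path : ∀ {k} → Fin N → Fin N → Vec (Fin N) (suc k) → Set where
    stop : ∀ {x} → Path x x (x ∷ [])
    step : ∀ {x z y k} {vs : Vec (Fin N) (suc k)} → E x z → Path z y vs → Path x y (x ∷ vs)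

  SimplePath : Fin N → Fin N → Set
  SimplePath x y = ∃[ k ] Σ (Vec (Fin N) (suc k)) λ vs → Path x y vs × Unique vs

  WithinSteps : ℕ → Fin N → Fin N → Set
  WithinSteps zero    x y = x ≡ y
  WithinSteps (suc k) x y = x ≡ y ⊎ ∃[ z ] E x z × WithinSteps k z y

  tail-from : ∀ {x z y k} {vs : Vec (Fin N) (suc k)} →
    Path z y vs → Unique vs → ¬ All (x ≢_) vs → SimplePath x y
  tail-from {x} {z} p u x∈vs with x ≟ z
  tail-from p u x∈vs | yes refl = _ , _ , p , u
  tail-from stop u x∈vs | no x≢z = ⊥-elim (x∈vs (x≢z ∷ []))
  tail-from (step e p) (_ ∷ u) x∈vs | no x≢z = tail-from p u (λ all → x∈vs (x≢z ∷ all))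

  star⇒simplePath : ∀ {x y} → Star E x y → SimplePath x y
  star⇒simplePath ε = _ , _ , stop , [] ∷ []
  star⇒simplePath {x} (e ◅ s) with star⇒simplePath s
  ... | k , vs , p , u with VecAll.all? (λ v → ¬? (x ≟ v)) vs
  ...   | yes x∉vs = suc k , x ∷ vs , step e p , x∉vs ∷ u
  ...   | no x∈vs = tail-from p u x∈vs

  path⇒withinSteps : ∀ {x y k m} {vs : Vec (Fin N) (suc k)} → k ≤ m → Path x y vs → WithinSteps m x y
  path⇒withinSteps {m = zero}  _         stop       = refl
  path⇒withinSteps {m = suc m} _         stop       = inj₁ refl
  path⇒withinSteps             (s≤s k≤m) (step e p) = inj₂ (_ , e , path⇒withinSteps k≤m p)

  withinSteps⇒star : ∀ k {x y} → WithinSteps k x y → Star E x y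
  withinSteps⇒star zero    refl               = ε
  withinSteps⇒star (suc k) (inj₁ refl)        = ε
  withinSteps⇒star (suc k) (inj₂ (z , e , w)) = e ◅ withinSteps⇒star k w

  withinSteps? : ∀ k → Decidable (WithinSteps k)
  withinSteps? zero    x y = x ≟ y
  withinSteps? (suc k) x y = (x ≟ y) ⊎-dec any? (λ z → E? x z ×-dec withinSteps? k z y)

  -- Pigeonhole: a simple path visits at most N vertices, so N steps always suffice.
  star⇒withinSteps : ∀ {x y} → Star E x y → WithinSteps N x y
  star⇒withinSteps s with star⇒simplePath s
  ... | k , vs , p , u = path⇒withinSteps (<⇒≤ (injective⇒≤ (lookup-injective u _ _))) p

  star? : Decidable (Star E)
  star? x y with withinSteps? N x y
  ... | yes w = yes (withinSteps⇒star N w)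
  ... | no ¬w = no λ s → ¬w (star⇒withinSteps s)

module Properties {N : ℕ} (S : Rel N) where

  prec⇒cover : ∀ {x y} → Prec S x y → Cover S x y
  prec⇒cover {x} {y} (x<y , no-middle) = x<y , between
    where
    between : ∀ z → S x z → S z y → z ≡ x ⊎ z ≡ y
    between z Sxz Szy with z ≟ x | z ≟ y
    ... | yes z≡x | _       = inj₁ z≡x
    ... | no _    | yes z≡y = inj₂ z≡y
    ... | no z≢x  | no z≢y  =
      ⊥-elim (no-middle z Sxz Szy ((λ min → z≢x (sym (min x Sxz))) , (λ max → z≢y (sym (max y Szy)))))

  prec⇒minimal : (∀ {z} → S z z) → ∀ {x y} → Prec S x y → Minimal S x
  prec⇒minimal refl-S {x} {y} ((Sxy , x≢y) , no-middle) z Szx with z ≟ x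
  ... | yes z≡x = z≡x
  ... | no z≢x  =
    ⊥-elim (no-middle x refl-S Sxy ((λ min → z≢x (min z Szx)) , (λ max → x≢y (sym (max y Sxy)))))

  prec⇒maximal : (∀ {z} → S z z) → ∀ {x y} → Prec S x y → Maximal S y
  prec⇒maximal refl-S {x} {y} ((Sxy , x≢y) , no-middle) z Syz with z ≟ y
  ... | yes z≡y = z≡y
  ... | no z≢y  =
    ⊥-elim (no-middle y Sxy refl-S ((λ min → x≢y (min x Sxy)) , (λ max → z≢y (max z Syz))))

  cover⇒prec : ∀ {x y} → Cover S x y → Minimal S x → Maximal S y → Prec S x y
  cover⇒prec {x} {y} (x<y , between) x-min y-max = x<y , λ z Sxz Szy → not-middle z (between z Sxz Szy)
    where
    not-middle : ∀ z → z ≡ x ⊎ z ≡ y → ¬ Middle S z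
    not-middle z (inj₁ refl) (¬min , _) = ¬min x-min
    not-middle z (inj₂ refl) (_ , ¬max) = ¬max y-max

  middle-of-covers : ∀ {u v w} → Cover S u v → Cover S v w → Middle S v
  middle-of-covers ((Suv , u≢v) , _) ((Svw , v≢w) , _) =
    (λ min → u≢v (min _ Suv)) , (λ max → v≢w (sym (max _ Svw)))

  minus-reflexive : ∀ {a b} → a ≢ b → (∀ {z} → S z z) → ∀ {z} → Minus S a b z z
  minus-reflexive a≢b refl-S = refl-S , λ { (refl , z≡b) → a≢b z≡b }

  minimal-minus : ∀ {a b x} → Minimal S x → Minimal (Minus S a b) x
  minimal-minus min z (Szx , _) = min z Szx

  maximal-minus : ∀ {a b y} → Maximal S y → Maximal (Minus S a b) y
  maximal-minus max z (Syz , _) = max z Syz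

  minimal-unminus : ∀ {a b x} → x ≢ b → Minimal (Minus S a b) x → Minimal S x
  minimal-unminus x≢b min z Szx = min z (Szx , λ (_ , x≡b) → x≢b x≡b)

  maximal-unminus : ∀ {a b y} → y ≢ a → Maximal (Minus S a b) y → Maximal S y
  maximal-unminus y≢a max z Syz = max z (Syz , λ (y≡a , _) → y≢a y≡a)

  cover-unminus : ∀ {a b x y} → x ≢ a → y ≢ b → Cover (Minus S a b) x y → Cover S x y
  cover-unminus x≢a y≢b (((Sxy , _) , x≢y) , between) =
    (Sxy , x≢y) , λ z Sxz Szy → between z (Sxz , λ (x≡a , _) → x≢a x≡a) (Szy , λ (_ , y≡b) → y≢b y≡b)

  minimal-minus-retract : ∀ {a b} → Minimal S a → (∀ z → Lt S z b → S z a) → Minimal (Minus S a b) b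
  minimal-minus-retract a-min below z (Szb , not-ab) with z ≟ _
  ... | yes z≡b = z≡b
  ... | no z≢b with a-min z (below z (Szb , z≢b))
  ...   | refl = ⊥-elim (not-ab (refl , refl))

  maximal-minus-retract : ∀ {a b} → Maximal S b → (∀ z → Lt S a z → S b z) → Maximal (Minus S a b) a
  maximal-minus-retract b-max above z (Saz , not-ab) with z ≟ _
  ... | yes z≡a = z≡a
  ... | no z≢a with b-max z (above z (Saz , λ a≡z → z≢a (sym a≡z)))
  ...   | refl = ⊥-elim (not-ab (refl , refl))

connected-mono : ∀ {N} {S T : Rel N} → (∀ {x y} → S x y → T x y) → Connected S → Connected T
connected-mono S⊆T conn x y = gmap id (λ { (inj₁ s) → inj₁ (S⊆T s) ; (inj₂ s) → inj₂ (S⊆T s) }) (conn x y)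

module _ {N : ℕ} {S : Rel N} (S? : Decidable S) where

  minimal? : ∀ x → Dec (Minimal S x)
  minimal? x = all? λ z → S? z x →-dec z ≟ x

  maximal? : ∀ x → Dec (Maximal S x)
  maximal? x = all? λ z → S? x z →-dec z ≟ x

  middle? : ∀ x → Dec (Middle S x)
  middle? x = ¬? (minimal? x) ×-dec ¬? (maximal? x)

  prec? : Decidable (Prec S)
  prec? a b = (S? a b ×-dec ¬? (a ≟ b)) ×-dec all? λ z → S? a z →-dec (S? z b →-dec ¬? (middle? z))

  connected? : Dec (Connected S)
  connected? = all? λ x → all? λ y → FiniteReachability.star? (λ u v → S? u v ⊎-dec S? v u) x y

  minus? : ∀ a b → Decidable (Minus S a b)
  minus? a b x y = S? x y ×-dec ¬? ((x ≟ a) ×-dec (y ≟ b))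

module _ {A : Set} {a b x y : A} where

  members-left : x ≡ a ⊎ x ≡ b → ∀ z → (z ≡ a ⊎ z ≡ b ⊎ z ≡ x ⊎ z ≡ y) ⇔ (z ≡ a ⊎ z ≡ b ⊎ z ≡ y)
  members-left x∈ab z = mk⇔ to from
    where
    to : z ≡ a ⊎ z ≡ b ⊎ z ≡ x ⊎ z ≡ y → z ≡ a ⊎ z ≡ b ⊎ z ≡ y
    to (inj₂ (inj₂ (inj₁ refl))) = [ inj₁ , inj₂ ∘ inj₁ ] x∈ab
    to (inj₂ (inj₂ (inj₂ z≡y)))  = inj₂ (inj₂ z≡y)
    to (inj₂ (inj₁ z≡b))         = inj₂ (inj₁ z≡b)
    to (inj₁ z≡a)                = inj₁ z≡a
    from : z ≡ a ⊎ z ≡ b ⊎ z ≡ y → z ≡ a ⊎ z ≡ b ⊎ z ≡ x ⊎ z ≡ y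
    from = Sum.map₂ (Sum.map₂ inj₂)

  members-right : y ≡ a ⊎ y ≡ b → ∀ z → (z ≡ a ⊎ z ≡ b ⊎ z ≡ x ⊎ z ≡ y) ⇔ (z ≡ x ⊎ z ≡ a ⊎ z ≡ b)
  members-right y∈ab z = mk⇔ to from
    where
    to : z ≡ a ⊎ z ≡ b ⊎ z ≡ x ⊎ z ≡ y → z ≡ x ⊎ z ≡ a ⊎ z ≡ b
    to (inj₂ (inj₂ (inj₂ refl))) = inj₂ y∈ab
    to (inj₂ (inj₂ (inj₁ z≡x)))  = inj₁ z≡x
    to (inj₂ (inj₁ z≡b))         = inj₂ (inj₂ z≡b)
    to (inj₁ z≡a)                = inj₂ (inj₁ z≡a)
    from : z ≡ x ⊎ z ≡ a ⊎ z ≡ b → z ≡ a ⊎ z ≡ b ⊎ z ≡ x ⊎ z ≡ y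
    from = [ inj₂ ∘ inj₂ ∘ inj₁ , Sum.map₂ inj₁ ]

ChainThrough : {n : ℕ} → Rel n → (a b x y : Fin n) → Set
ChainThrough R a b x y =
    ∃[ u ] ∃[ v ] ∃[ w ]
      ( (∀ z → (z ≡ a ⊎ z ≡ b ⊎ z ≡ x ⊎ z ≡ y) ⇔ (z ≡ u ⊎ z ≡ v ⊎ z ≡ w))
      × Cover R u v × Cover R v w × Minimal R u × Maximal R w
      × (Minimal R x × Maximal R y → ∀ z → R u z → R z w → z ≡ u ⊎ z ≡ v ⊎ z ≡ w)
      × (Middle R x → IRetractable R b a)
      × (Middle R y → IRetractable R a b))

module _ {N : ℕ} {R : Rel N} (po : IsPartialOrder _≡_ R) where

  open IsPartialOrder po using (antisym) renaming (refl to R-refl; trans to R-trans)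
  open Properties R

  data StepOf (u v w : Fin N) : Fin N → Fin N → Set where
    lower : StepOf u v w u v
    upper : StepOf u v w v w
    outer : StepOf u v w u w

  step-of-chain : ∀ {u v w s t} → Minimal R u → Maximal R w → u ≢ v → v ≢ w →
    s ≡ u ⊎ s ≡ v ⊎ s ≡ w → t ≡ u ⊎ t ≡ v ⊎ t ≡ w → Lt R s t → StepOf u v w s t
  step-of-chain _ _ _ _ (inj₁ refl) (inj₂ (inj₁ refl)) _ = lower
  step-of-chain _ _ _ _ (inj₁ refl) (inj₂ (inj₂ refl)) _ = outer
  step-of-chain _ _ _ _ (inj₂ (inj₁ refl)) (inj₂ (inj₂ refl)) _ = upper
  step-of-chain _ _ _ _ (inj₁ refl) (inj₁ refl) (_ , s≢t) = ⊥-elim (s≢t refl)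
  step-of-chain _ _ _ _ (inj₂ (inj₁ refl)) (inj₂ (inj₁ refl)) (_ , s≢t) = ⊥-elim (s≢t refl)
  step-of-chain u-min _ u≢v _ (inj₂ (inj₁ refl)) (inj₁ refl) (Rvu , _) = ⊥-elim (u≢v (sym (u-min _ Rvu)))
  step-of-chain _ w-max _ _ (inj₂ (inj₂ refl)) _ (Rwt , w≢t) = ⊥-elim (w≢t (sym (w-max _ Rwt)))

  skips-middle : ∀ {u v w} → Cover R u v → Cover R v w → ¬ Cover R u w
  skips-middle ((Ruv , u≢v) , _) ((Rvw , v≢w) , _) (_ , between) with between _ Ruv Rvw
  ... | inj₁ v≡u = u≢v (sym v≡u)
  ... | inj₂ v≡w = v≢w v≡w

  retraction-below : ∀ {a b} → IRetractable R b a → R a b → ∀ z → Lt R z b → R z a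
  retraction-below (inj₁ (_ , below)) _ = below
  retraction-below (inj₂ ((Rba , b≢a) , _)) Rab = ⊥-elim (b≢a (antisym Rba Rab))

  retraction-above : ∀ {a b} → IRetractable R a b → R a b → ∀ z → Lt R a z → R b z
  retraction-above (inj₂ (_ , above)) _ = above
  retraction-above (inj₁ ((Rba , b≢a) , _)) Rab = ⊥-elim (b≢a (antisym Rba Rab))

  -- (a,b) and (x,y) are distinct steps of u ⋖ v ⋖ w (neither is u ⋖ w, which skips v).
  extremal-of-chain : ∀ {a b x y} → Cover R a b → Cover (Minus R a b) x y →
    ChainThrough R a b x y → Minimal (Minus R a b) x × Maximal (Minus R a b) y
  extremal-of-chain {a} {b} {x} {y} a⋖b@((Rab , a≢b) , _) (((Rxy , not-ab) , x≢y) , _)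
                    (u , v , w , members , u⋖v , v⋖w , u-min , w-max , _ , x-mid , y-mid)
    with step (inj₂ (inj₂ (inj₁ refl))) (inj₂ (inj₂ (inj₂ refl))) (Rxy , x≢y)
       | step (inj₁ refl) (inj₂ (inj₁ refl)) (Rab , a≢b)
    where
    step : ∀ {s t} → s ≡ a ⊎ s ≡ b ⊎ s ≡ x ⊎ s ≡ y → t ≡ a ⊎ t ≡ b ⊎ t ≡ x ⊎ t ≡ y →
      Lt R s t → StepOf u v w s t
    step s∈ t∈ = step-of-chain u-min w-max (proj₂ (proj₁ u⋖v)) (proj₂ (proj₁ v⋖w))
                   (Equivalence.to (members _) s∈) (Equivalence.to (members _) t∈)
  ... | _     | outer = ⊥-elim (skips-middle u⋖v v⋖w a⋖b)
  ... | lower | lower = ⊥-elim (not-ab (refl , refl))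
  ... | upper | upper = ⊥-elim (not-ab (refl , refl))
  ... | outer | _     = minimal-minus u-min , maximal-minus w-max
  ... | lower | upper = minimal-minus u-min ,
                        maximal-minus-retract w-max (retraction-above (y-mid (middle-of-covers u⋖v v⋖w)) Rab)
  ... | upper | lower = minimal-minus-retract u-min (retraction-below (x-mid (middle-of-covers u⋖v v⋖w)) Rab) ,
                        maximal-minus w-max

  chain-from-b : ∀ {a b y} → Cover R a b → Cover (Minus R a b) b y → Minimal (Minus R a b) b →
    Maximal (Minus R a b) y → ChainThrough R a b b y
  chain-from-b {a} {b} {y} a⋖b@((Rab , a≢b) , _) b⋖yQ@(((Rby , _) , b≢y) , _) b-minQ y-maxQ =
    a , b , y , members-left (inj₂ refl) , a⋖b , cover-unminus (λ b≡a → a≢b (sym b≡a)) (λ y≡b → b≢y (sym y≡b)) b⋖yQ ,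
    a-min , y-max , (λ (b-min , _) → ⊥-elim (a≢b (b-min a Rab))) , (λ _ → inj₁ ((Rab , a≢b) , below-b)) ,
    (λ y-mid → ⊥-elim (proj₂ y-mid y-max))
    where
    below-b : ∀ z → Lt R z b → R z a
    below-b z (Rzb , z≢b) with z ≟ a
    ... | yes refl = R-refl
    ... | no z≢a   = ⊥-elim (z≢b (b-minQ z (Rzb , λ (z≡a , _) → z≢a z≡a)))
    a-min : Minimal R a
    a-min z Rza with z ≟ a
    ... | yes z≡a = z≡a
    ... | no z≢a with b-minQ z (R-trans Rza Rab , λ (z≡a , _) → z≢a z≡a)
    ...   | refl = ⊥-elim (a≢b (antisym Rab Rza))
    y-max : Maximal R y
    y-max = maximal-unminus (λ { refl → a≢b (antisym Rab Rby) }) y-maxQ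

  chain-to-a : ∀ {a b x} → Cover R a b → Cover (Minus R a b) x a → Minimal (Minus R a b) x →
    Maximal (Minus R a b) a → ChainThrough R a b x a
  chain-to-a {a} {b} {x} a⋖b@((Rab , a≢b) , _) x⋖aQ@(((Rxa , _) , x≢a) , _) x-minQ a-maxQ =
    x , a , b , members-right (inj₁ refl) , cover-unminus x≢a a≢b x⋖aQ , a⋖b ,
    x-min , b-max , (λ (_ , a-max) → ⊥-elim (a≢b (sym (a-max b Rab)))) , (λ x-mid → ⊥-elim (proj₁ x-mid x-min)) ,
    (λ _ → inj₂ ((Rab , a≢b) , above-a))
    where
    above-a : ∀ z → Lt R a z → R b z
    above-a z (Raz , a≢z) with z ≟ b
    ... | yes refl = R-refl
    ... | no z≢b   = ⊥-elim (a≢z (sym (a-maxQ z (Raz , λ (_ , z≡b) → z≢b z≡b))))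
    b-max : Maximal R b
    b-max z Rbz with z ≟ b
    ... | yes z≡b = z≡b
    ... | no z≢b with a-maxQ z (R-trans Rab Rbz , λ (_ , z≡b) → z≢b z≡b)
    ...   | refl = ⊥-elim (a≢b (antisym Rab Rbz))
    x-min : Minimal R x
    x-min = minimal-unminus (λ { refl → a≢b (antisym Rab Rxa) }) x-minQ

  module _ (R? : Decidable R) where

    chain-from-a : ∀ {a b y} → Cover R a b → Cover (Minus R a b) a y → Minimal (Minus R a b) a →
      Maximal (Minus R a b) y → ¬ Prec R a y → ChainThrough R a b a y
    chain-from-a {a} {b} {y} a⋖b@((Rab , a≢b) , _) (((Ray , not-ab) , a≢y) , betweenQ) a-minQ y-maxQ a⊀y =
      chain (R? b y)
      where
      y≢b : y ≢ b
      y≢b refl = not-ab (refl , refl)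
      a-min : Minimal R a
      a-min = minimal-unminus a≢b a-minQ
      y-max : Maximal R y
      y-max = maximal-unminus (λ y≡a → a≢y (sym y≡a)) y-maxQ
      between : ∀ z → R a z → R z y → z ≡ a ⊎ z ≡ b ⊎ z ≡ y
      between z Raz Rzy with z ≟ b
      ... | yes z≡b = inj₂ (inj₁ z≡b)
      ... | no z≢b  = Sum.map₂ inj₂ (betweenQ z (Raz , λ (_ , z≡b) → z≢b z≡b) (Rzy , λ (_ , y≡b) → y≢b y≡b))
      above-b : ∀ z → R b z → R z y → z ≡ b ⊎ z ≡ y
      above-b z Rbz Rzy with between z (R-trans Rab Rbz) Rzy
      ... | inj₁ refl = ⊥-elim (a≢b (antisym Rab Rbz))
      ... | inj₂ z∈by = z∈by
      chain : Dec (R b y) → ChainThrough R a b a y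
      chain (yes Rby) =
        a , b , y , members-left (inj₁ refl) , a⋖b , ((Rby , λ b≡y → y≢b (sym b≡y)) , above-b) , a-min , y-max ,
        (λ _ → between) , (λ a-mid → ⊥-elim (proj₁ a-mid a-min)) , (λ y-mid → ⊥-elim (proj₂ y-mid y-max))
      chain (no ¬Rby) = ⊥-elim (a⊀y (cover⇒prec ((Ray , a≢y) , skip-b) a-min y-max))
        where
        skip-b : ∀ z → R a z → R z y → z ≡ a ⊎ z ≡ y
        skip-b z Raz Rzy with between z Raz Rzy
        ... | inj₂ (inj₁ refl) = ⊥-elim (¬Rby Rzy)
        ... | inj₁ z≡a         = inj₁ z≡a
        ... | inj₂ (inj₂ z≡y)  = inj₂ z≡y

    chain-to-b : ∀ {a b x} → Cover R a b → Cover (Minus R a b) x b → Minimal (Minus R a b) x →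
      Maximal (Minus R a b) b → ¬ Prec R x b → ChainThrough R a b x b
    chain-to-b {a} {b} {x} a⋖b@((Rab , a≢b) , _) (((Rxb , not-ab) , x≢b) , betweenQ) x-minQ b-maxQ x⊀b =
      chain (R? x a)
      where
      x≢a : x ≢ a
      x≢a refl = not-ab (refl , refl)
      x-min : Minimal R x
      x-min = minimal-unminus x≢b x-minQ
      b-max : Maximal R b
      b-max = maximal-unminus (λ b≡a → a≢b (sym b≡a)) b-maxQ
      between : ∀ z → R x z → R z b → z ≡ x ⊎ z ≡ a ⊎ z ≡ b
      between z Rxz Rzb with z ≟ a
      ... | yes z≡a = inj₂ (inj₁ z≡a)
      ... | no z≢a  = Sum.map₂ inj₂ (betweenQ z (Rxz , λ (x≡a , _) → x≢a x≡a) (Rzb , λ (z≡a , _) → z≢a z≡a))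
      below-a : ∀ z → R x z → R z a → z ≡ x ⊎ z ≡ a
      below-a z Rxz Rza with between z Rxz (R-trans Rza Rab)
      ... | inj₂ (inj₂ refl) = ⊥-elim (a≢b (antisym Rab Rza))
      ... | inj₁ z≡x         = inj₁ z≡x
      ... | inj₂ (inj₁ z≡a)  = inj₂ z≡a
      chain : Dec (R x a) → ChainThrough R a b x b
      chain (yes Rxa) =
        x , a , b , members-right (inj₂ refl) , ((Rxa , x≢a) , below-a) , a⋖b , x-min , b-max ,
        (λ _ → between) , (λ x-mid → ⊥-elim (proj₁ x-mid x-min)) , (λ b-mid → ⊥-elim (proj₂ b-mid b-max))
      chain (no ¬Rxa) = ⊥-elim (x⊀b (cover⇒prec ((Rxb , x≢b) , skip-a) x-min b-max))
        where
        skip-a : ∀ z → R x z → R z b → z ≡ x ⊎ z ≡ b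
        skip-a z Rxz Rzb with between z Rxz Rzb
        ... | inj₂ (inj₁ refl) = ⊥-elim (¬Rxa Rxz)
        ... | inj₁ z≡x         = inj₁ z≡x
        ... | inj₂ (inj₂ z≡b)  = inj₂ z≡b

    chain-of-obstruction : ∀ {a b x y} → Cover R a b → Cover (Minus R a b) x y → Minimal (Minus R a b) x →
      Maximal (Minus R a b) y → ¬ Prec R x y → ChainThrough R a b x y
    chain-of-obstruction {a} {b} {x} {y} a⋖b x⋖y x-min y-max x⊀y with x ≟ a | y ≟ b | x ≟ b | y ≟ a
    ... | yes refl | _        | _        | _        = chain-from-a a⋖b x⋖y x-min y-max x⊀y
    ... | no _     | yes refl | _        | _        = chain-to-b a⋖b x⋖y x-min y-max x⊀y
    ... | no _     | no _     | yes refl | _        = chain-from-b a⋖b x⋖y x-min y-max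
    ... | no _     | no _     | no _     | yes refl = chain-to-a a⋖b x⋖y x-min y-max
    ... | no x≢a   | no y≢b   | no x≢b   | no y≢a   =
      ⊥-elim (x⊀y (cover⇒prec (cover-unminus x≢a y≢b x⋖y) (minimal-unminus x≢b x-min) (maximal-unminus y≢a y-max)))

  three-chain⇒¬fpp : ∀ {a b} → Cover R a b → ThreeChainProperty R a b → ¬ HasFPPGraph (Minus R a b)
  three-chain⇒¬fpp a⋖b (x , y , x⋖y , conn , chain) (_ , fpp) =
    let (x-min , y-max) = extremal-of-chain a⋖b x⋖y chain
    in  fpp x y (Properties.cover⇒prec _ x⋖y x-min y-max) conn

  ¬fpp⇒three-chain : Decidable R → ∀ {a b} → Cover R a b → Connected (Minus R a b) →
    HasFPPGraph R → ¬ HasFPPGraph (Minus R a b) → ThreeChainProperty R a b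
  ¬fpp⇒three-chain R? {a} {b} a⋖b@((_ , a≢b) , _) conn-Q (_ , fpp-R) ¬fpp-Q
    with any? (λ x → any? (λ y → prec? Q? x y ×-dec connected? (minus? Q? x y)))
    where
    Q? : Decidable (Minus R a b)
    Q? = minus? R? a b
  ... | no none = ⊥-elim (¬fpp-Q (conn-Q , λ x y x≺y conn → none (x , y , x≺y , conn)))
  ... | yes (x , y , x≺y , conn) =
    x , y , Q.prec⇒cover x≺y , conn ,
    chain-of-obstruction R? a⋖b (Q.prec⇒cover x≺y) (Q.prec⇒minimal Q-refl x≺y) (Q.prec⇒maximal Q-refl x≺y)
      λ x≺y-in-R → fpp-R x y x≺y-in-R (connected-mono (λ ((Rst , _) , not-xy) → Rst , not-xy) conn)
    where
    module Q = Properties (Minus R a b)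
    Q-refl : ∀ {z} → Minus R a b z z
    Q-refl = minus-reflexive a≢b R-refl

proposition1 : (n : ℕ) (R : Rel (suc n)) → IsPartialOrder _≡_ R → Decidable R →
    Connected R → (a b : Fin (suc n)) → Cover R a b → Connected (Minus R a b) →
    (ThreeChainProperty R a b → ¬ HasFPPGraph (Minus R a b))
    × (HasFPPGraph R → ¬ HasFPPGraph (Minus R a b) → ThreeChainProperty R a b)
proposition1 n R po R? _ a b a⋖b conn-Q = three-chain⇒¬fpp po a⋖b , ¬fpp⇒three-chain po R? a⋖b conn-Q
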